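{- Let $X$ be a finite totally ordered alphabet and $U\subseteq X\times X$. Suppose $\mathrm{inv}'_U$ and $\mathrm{maj}'_U$ are equidistributed on every rearrangement class of words over $X$. If $x,y\in X$, $x\ne y$, $(x,y)\in U$ and $(y,x)\in U$, then $(x,x)\in U$ and $(y,y)\in U$.
   Context: Words over $X$: finite sequences $w=x_1\cdots x_m$; a rearrangement class is the set of all words with prescribed numbers of occurrences of each letter. $\mathrm{maj}'_U w=\sum_{i=1}^{m-1}i\,\chi((x_i,x_{i+1})\in U)$, $\mathrm{inv}'_U w=\sum_{1\le i<j\le m}\chi((x_i,x_j)\in U)$, $\chi$ the truth indicator. Equidistributed on a class: for each integer $k$ the numbers of words in the class with statistic value $k$ coincide. -}

module Defs where

open import Data.Nat using (ℕ; zero; suc; _+_; _*_; _≡ᵇ_)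
import Data.Bool
import Data.Nat
open import Data.Bool using (Bool; true; false; if_then_else_; _∧_)
open import Data.Fin using (Fin)
open import Data.Fin.Properties using (_≟_)
open import Data.List using (List; []; _∷_; length; filter; map; concatMap; allFin; foldr)
open import Relation.Nullary.Decidable using (does)
open import Relation.Binary.PropositionalEquality using (_≡_)

Word : ℕ → Set
Word n = List (Fin n)

Rel : ℕ → Set
Rel n = Fin n → Fin n → Bool

χ : Bool → ℕ
χ true  = 1
χ false = 0

-- inv'_U w = Σ_{1 ≤ i < j ≤ m} χ((x_i , x_j) ∈ U)
inv′ : ∀ {n} → Rel n → Word n → ℕ
inv′ U []      = 0
inv′ U (x ∷ w) = foldr (λ y acc → χ (U x y) + acc) 0 w + inv′ U w

-- majAux U i w: sum over consecutive positions, first position of w having index i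
majAux : ∀ {n} → Rel n → ℕ → Word n → ℕ
majAux U i []            = 0
majAux U i (x ∷ [])      = 0
majAux U i (x ∷ y ∷ w)   = i * χ (U x y) + majAux U (suc i) (y ∷ w)

-- maj'_U w = Σ_{i=1}^{m-1} i χ((x_i , x_{i+1}) ∈ U)
maj′ : ∀ {n} → Rel n → Word n → ℕ
maj′ U w = majAux U 1 w

occ : ∀ {n} → Fin n → Word n → ℕ
occ a []      = 0
occ a (x ∷ w) = (if does (a ≟ x) then 1 else 0) + occ a w

allWords : (n m : ℕ) → List (Word n)
allWords n zero    = [] ∷ []
allWords n (suc m) = concatMap (λ x → map (x ∷_) (allWords n m)) (allFin n)

total : ∀ {n} → (Fin n → ℕ) → ℕ
total {n} c = foldr _+_ 0 (map c (allFin n))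

hasContent : ∀ {n} → (Fin n → ℕ) → Word n → Bool
hasContent {n} c w = foldr _∧_ true (map (λ a → occ a w ≡ᵇ c a) (allFin n))

rearrClass : ∀ {n} → (Fin n → ℕ) → List (Word n)
rearrClass {n} c = filter (λ w → Data.Bool._≟_ (hasContent c w) true) (allWords n (total c))

countStat : ∀ {n} → (Word n → ℕ) → ℕ → List (Word n) → ℕ
countStat s k ws = length (filter (λ w → Data.Nat._≟_ (s w) k) ws)

Equidistributed : ∀ {n} → Rel n → Set
Equidistributed {n} U =
  (c : Fin n → ℕ) (k : ℕ) →
  countStat (inv′ U) k (rearrClass c) ≡ countStat (maj′ U) k (rearrClass c)

-- In the class {xxy, xyx, yxx}, if (x, x) ∉ U while (x, y), (y, x) ∈ U, then inv′_U equals 2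
-- on all three words whereas maj′_U takes the values 2, 3, 1, so the two statistics are not
-- equidistributed there.  To enumerate that class over an arbitrary alphabet, note that
-- rearrangement classes commute with injective renamings of the alphabet: the class of xxy is
-- the image of the class of 001 over {0, 1}, which is computed by evaluation.
module Submission where

open import Defs
open import Data.Bool using (Bool; true; false; if_then_else_)
open import Data.Bool.Properties using (T-≡)
open import Data.Fin using (Fin; zero; suc)
open import Data.Fin.Properties using (_≟_; any?)
open import Data.List
  using (List; []; _∷_; _++_; length; filter; map; concatMap; allFin; foldr; tabulate; cartesianProductWith)
open import Data.List.Membership.Propositional using (_∈_)
open import Data.List.Membership.Propositional.Properties
  using (∈-allFin; ∈-map⁺; ∈-map⁻; ∈-filter⁺; ∈-filter⁻; ∈-cartesianProductWith⁺)
open import Data.List.Membership.Propositional.Properties.WithK using (unique∧set⇒bag)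
open import Data.List.Properties using (∷-injective; map-injective; map-cong)
open import Data.List.Relation.Binary.BagAndSetEquality using (∼bag⇒↭)
open import Data.List.Relation.Binary.Permutation.Propositional using (_↭_)
open import Data.List.Relation.Binary.Permutation.Propositional.Properties using (filter-↭; ↭-length)
open import Data.List.Relation.Unary.All as All using ()
open import Data.List.Relation.Unary.All.Properties using (all⁺; all⁻)
open import Data.List.Relation.Unary.Any using (here; there)
open import Data.List.Relation.Unary.AllPairs.Core as AllPairs using ()
open import Data.List.Relation.Unary.Unique.Propositional using (Unique)
open import Data.List.Relation.Unary.Unique.Propositional.Properties
  using (allFin⁺; cartesianProductWith⁺; filter⁺; map⁺)
open import Data.Nat using (ℕ; zero; suc; _+_)
import Data.Nat
open import Data.Nat.Properties using (≡ᵇ⇒≡; ≡⇒≡ᵇ; +-0-commutativeMonoid)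
open import Algebra.Properties.CommutativeMonoid.Sum +-0-commutativeMonoid
  using (sum; ∑-distrib-+; sum-replicate-zero)
open import Data.Product using (_×_; _,_; proj₂; curry; ∃-syntax)
open import Function using (_∘_; _⇔_; mk⇔; Equivalence)
open import Function.Definitions using (Injective)
open import Relation.Nullary using (¬_; yes; no; contradiction)
open import Relation.Nullary.Decidable using (does)
open import Relation.Binary.PropositionalEquality
  using (_≡_; _≢_; refl; sym; trans; cong; cong₂; subst; ≢-sym; module ≡-Reasoning)

private
  variable
    m n : ℕ

content : Word n → Fin n → ℕ
content w a = occ a w

concatMap-map≡cartesianProductWith : ∀ {A B C : Set} (f : A → B → C) (xs : List A) (ys : List B) →
  concatMap (λ a → map (f a) ys) xs ≡ cartesianProductWith f xs ys
concatMap-map≡cartesianProductWith f []       ys = refl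
concatMap-map≡cartesianProductWith f (x ∷ xs) ys =
  cong (map (f x) ys ++_) (concatMap-map≡cartesianProductWith f xs ys)

allWords-suc : ∀ n m → allWords n (suc m) ≡ cartesianProductWith _∷_ (allFin n) (allWords n m)
allWords-suc n m = concatMap-map≡cartesianProductWith _∷_ (allFin n) (allWords n m)

∈-allWords : (w : Word n) → w ∈ allWords n (length w)
∈-allWords []      = here refl
∈-allWords (a ∷ w) = subst (a ∷ w ∈_) (sym (allWords-suc _ (length w)))
  (∈-cartesianProductWith⁺ _∷_ (∈-allFin a) (∈-allWords w))

allWords-unique : ∀ n m → Unique (allWords n m)
allWords-unique n zero    = All.[] AllPairs.∷ AllPairs.[]
allWords-unique n (suc m) = subst Unique (sym (allWords-suc n m))
  (cartesianProductWith⁺ _∷_ ∷-injective (allFin⁺ n) (allWords-unique n m))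

foldr-+-map-tabulate : ∀ {k} (c : Fin n → ℕ) (f : Fin k → Fin n) →
  foldr _+_ 0 (map c (tabulate f)) ≡ sum (c ∘ f)
foldr-+-map-tabulate {k = zero}  c f = refl
foldr-+-map-tabulate {k = suc k} c f = cong (c (f zero) +_) (foldr-+-map-tabulate c (f ∘ suc))

sum-indicator : (z : Fin n) → sum (λ a → if does (a ≟ z) then 1 else 0) ≡ 1
sum-indicator {suc n} zero    = cong suc (sum-replicate-zero n)
sum-indicator {suc n} (suc z) = sum-indicator z

sum-content : (w : Word n) → sum (content w) ≡ length w
sum-content {n} []      = sum-replicate-zero n
sum-content     (z ∷ w) =
  trans (∑-distrib-+ _ (content w)) (cong₂ _+_ (sum-indicator z) (sum-content w))

total-content : (w : Word n) → total (content w) ≡ length w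
total-content w = trans (foldr-+-map-tabulate (content w) (λ a → a)) (sum-content w)

hasContent⇔ : (c : Fin n → ℕ) (w : Word n) → hasContent c w ≡ true ⇔ (∀ a → occ a w ≡ c a)
hasContent⇔ {n} c w = mk⇔
  (λ h a → ≡ᵇ⇒≡ _ _ (All.lookup (all⁺ agrees (allFin n) (Equivalence.from T-≡ h)) (∈-allFin a)))
  (λ p → Equivalence.to T-≡ (all⁻ agrees {allFin n} (All.tabulate λ {a} _ → ≡⇒≡ᵇ _ _ (p a))))
  where
  agrees : Fin n → Bool
  agrees a = occ a w Data.Nat.≡ᵇ c a

∈-rearrClass⇔ : (c : Fin n → ℕ) (v : Word n) → v ∈ rearrClass c ⇔ (∀ a → occ a v ≡ c a)
∈-rearrClass⇔ {n} c v = mk⇔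
  (λ v∈ → Equivalence.to (hasContent⇔ c v)
            (proj₂ (∈-filter⁻ _ {xs = allWords n (total c)} v∈)))
  (λ p → ∈-filter⁺ _ (subst (λ m → v ∈ allWords n m) (length≡total p) (∈-allWords v))
                      (Equivalence.from (hasContent⇔ c v) p))
  where
  length≡total : (∀ a → occ a v ≡ c a) → length v ≡ total c
  length≡total p = trans (sym (total-content v)) (cong (foldr _+_ 0) (map-cong p (allFin n)))

rearrClass-unique : (c : Fin n → ℕ) → Unique (rearrClass c)
rearrClass-unique {n} c = filter⁺ _ (allWords-unique n (total c))

occ≢0⇒∈ : ∀ {a : Fin n} w → occ a w ≢ 0 → a ∈ w
occ≢0⇒∈         []      occ≢0 = contradiction refl occ≢0
occ≢0⇒∈ {a = a} (b ∷ w) occ≢0 with a ≟ b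
... | yes refl = here refl
... | no _     = there (occ≢0⇒∈ w occ≢0)

∈⇒occ≢0 : ∀ {a : Fin n} {w} → a ∈ w → occ a w ≢ 0
∈⇒occ≢0 {a = a} (here refl) with a ≟ a
... | yes _   = λ ()
... | no a≢a  = contradiction refl a≢a
∈⇒occ≢0 {a = a} {b ∷ _} (there a∈w) with a ≟ b
... | yes _ = λ ()
... | no _  = ∈⇒occ≢0 a∈w

module _ (e : Fin m → Fin n) where

  occ-map : Injective _≡_ _≡_ e → ∀ a w → occ (e a) (map e w) ≡ occ a w
  occ-map inj a []      = refl
  occ-map inj a (b ∷ w) with e a ≟ e b | a ≟ b
  ... | yes _     | yes _    = cong suc (occ-map inj a w)
  ... | yes ea≡eb | no a≢b   = contradiction (inj ea≡eb) a≢b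
  ... | no ea≢eb  | yes refl = contradiction refl ea≢eb
  ... | no _      | no _     = occ-map inj a w

  occ-map-∉image : ∀ {a} → (∀ b → e b ≢ a) → ∀ w → occ a (map e w) ≡ 0
  occ-map-∉image         a∉e []      = refl
  occ-map-∉image {a = a} a∉e (b ∷ w) with a ≟ e b
  ... | yes a≡eb = contradiction (sym a≡eb) (a∉e b)
  ... | no _     = occ-map-∉image a∉e w

  map-preserves-content : Injective _≡_ _≡_ e → ∀ u w → (∀ b → occ b u ≡ occ b w) →
    ∀ a → occ a (map e u) ≡ occ a (map e w)
  map-preserves-content inj u w same a with any? (λ b → e b ≟ a)
  ... | yes (b , refl) = trans (occ-map inj b u) (trans (same b) (sym (occ-map inj b w)))
  ... | no a∉e         =
    trans (occ-map-∉image (curry a∉e) u) (sym (occ-map-∉image (curry a∉e) w))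

  map-preimage : (v : Word n) → (∀ {a} → a ∈ v → ∃[ b ] e b ≡ a) → ∃[ u ] map e u ≡ v
  map-preimage []      _      = [] , refl
  map-preimage (a ∷ v) v⊆im with v⊆im (here refl) | map-preimage v (v⊆im ∘ there)
  ... | b , refl | u , refl = b ∷ u , refl

  rearrClass-map : Injective _≡_ _≡_ e → (w : Word m) →
    rearrClass (content (map e w)) ↭ map (map e) (rearrClass (content w))
  rearrClass-map inj w = ∼bag⇒↭ (unique∧set⇒bag
    (rearrClass-unique _) (map⁺ (map-injective inj) (rearrClass-unique _)) (mk⇔ to from))
    where
    open ≡-Reasoning

    content-in-image : ∀ {v a} → (∀ a → occ a v ≡ occ a (map e w)) → a ∈ v → ∃[ b ] e b ≡ a
    content-in-image same a∈v
      with b , _ , a≡eb ← ∈-map⁻ e (occ≢0⇒∈ (map e w) λ occ≡0 →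
                                     ∈⇒occ≢0 a∈v (trans (same _) occ≡0))
      = b , sym a≡eb

    to : ∀ {v} → v ∈ rearrClass (content (map e w)) → v ∈ map (map e) (rearrClass (content w))
    to {v} v∈ = rename (Equivalence.to (∈-rearrClass⇔ _ v) v∈)
      where
      rename : (∀ a → occ a v ≡ occ a (map e w)) → v ∈ map (map e) (rearrClass (content w))
      rename same with u , refl ← map-preimage v (content-in-image same) =
        ∈-map⁺ (map e) (Equivalence.from (∈-rearrClass⇔ _ u) λ b → begin
          occ b u               ≡⟨ sym (occ-map inj b u) ⟩
          occ (e b) (map e u)   ≡⟨ same (e b) ⟩
          occ (e b) (map e w)   ≡⟨ occ-map inj b w ⟩
          occ b w               ∎)

    from : ∀ {v} → v ∈ map (map e) (rearrClass (content w)) → v ∈ rearrClass (content (map e w))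
    from v∈ with u , u∈ , refl ← ∈-map⁻ (map e) v∈ =
      Equivalence.from (∈-rearrClass⇔ _ _)
        (map-preserves-content inj u w (Equivalence.to (∈-rearrClass⇔ _ u) u∈))

countStat-↭ : (s : Word n → ℕ) (k : ℕ) {L L′ : List (Word n)} → L ↭ L′ →
  countStat s k L ≡ countStat s k L′
countStat-↭ s k L↭L′ = ↭-length (filter-↭ _ L↭L′)

countStat-values : (s : Word n → ℕ) (k : ℕ) (L : List (Word n)) →
  countStat s k L ≡ length (filter (Data.Nat._≟ k) (map s L))
countStat-values s k []      = refl
countStat-values s k (w ∷ L) with s w Data.Nat.≡ᵇ k
... | true  = cong suc (countStat-values s k L)
... | false = countStat-values s k L

module _ {x y : Fin n} (x≢y : x ≢ y) where

  xxy-class : List (Word n)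
  xxy-class = (x ∷ x ∷ y ∷ []) ∷ (x ∷ y ∷ x ∷ []) ∷ (y ∷ x ∷ x ∷ []) ∷ []

  pair : Fin 2 → Fin n
  pair zero    = x
  pair (suc _) = y

  pair-injective : Injective _≡_ _≡_ pair
  pair-injective {zero}     {zero}     _     = refl
  pair-injective {zero}     {suc zero} x≡y   = contradiction x≡y x≢y
  pair-injective {suc zero} {zero}     y≡x   = contradiction (sym y≡x) x≢y
  pair-injective {suc zero} {suc zero} _     = refl

  -- The right-hand side is the image under pair of rearrClass over Fin 2, evaluated.
  rearrClass-xxy : rearrClass (content (x ∷ x ∷ y ∷ [])) ↭ xxy-class
  rearrClass-xxy = rearrClass-map pair pair-injective (zero ∷ zero ∷ suc zero ∷ [])

  countStat-xxy : (s : Word n → ℕ) (k : ℕ) →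
    countStat s k (rearrClass (content (x ∷ x ∷ y ∷ [])))
      ≡ length (filter (Data.Nat._≟ k) (map s xxy-class))
  countStat-xxy s k = trans (countStat-↭ s k rearrClass-xxy) (countStat-values s k xxy-class)

  module _ {U : Rel n} (xx : U x x ≡ false) (xy : U x y ≡ true) (yx : U y x ≡ true) where

    inv′-xxy-class : map (inv′ U) xxy-class ≡ 2 ∷ 2 ∷ 2 ∷ []
    inv′-xxy-class rewrite xx | xy | yx = refl

    maj′-xxy-class : map (maj′ U) xxy-class ≡ 2 ∷ 3 ∷ 1 ∷ []
    maj′-xxy-class rewrite xx | xy | yx = refl

    ¬equidistributed : ¬ Equidistributed U
    ¬equidistributed equi = contradiction (begin
      3                                                 ≡⟨ cong count2 inv′-xxy-class ⟨
      count2 (map (inv′ U) xxy-class)                   ≡⟨ countStat-xxy (inv′ U) 2 ⟨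
      countStat (inv′ U) 2 (rearrClass (content xxy))   ≡⟨ equi (content xxy) 2 ⟩
      countStat (maj′ U) 2 (rearrClass (content xxy))   ≡⟨ countStat-xxy (maj′ U) 2 ⟩
      count2 (map (maj′ U) xxy-class)                   ≡⟨ cong count2 maj′-xxy-class ⟩
      1                                                 ∎) λ ()
      where
      open ≡-Reasoning
      xxy : Word n
      xxy = x ∷ x ∷ y ∷ []
      count2 : List ℕ → ℕ
      count2 ks = length (filter (Data.Nat._≟ 2) ks)

equidistributed⇒diagonal : (U : Rel n) → Equidistributed U →
  ∀ {x y} → x ≢ y → U x y ≡ true → U y x ≡ true → U x x ≡ true
equidistributed⇒diagonal U equi {x} x≢y xy yx with U x x in xx
... | true  = refl
... | false = contradiction equi (¬equidistributed x≢y xx xy yx)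

lemma6p2 : (n : ℕ) (U : Rel n) → Equidistributed U →
    (x y : Fin n) → x ≢ y → U x y ≡ true → U y x ≡ true →
    (U x x ≡ true) × (U y y ≡ true)
lemma6p2 n U equi x y x≢y xy yx =
  equidistributed⇒diagonal U equi x≢y xy yx , equidistributed⇒diagonal U equi (≢-sym x≢y) yx xy
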